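{- The reduction relation $\to_{\lambda j}$ is confluent: for all terms $t,u_1,u_2$ such that $t\to_{\lambda j}^* u_1$ and $t\to_{\lambda j}^* u_2$, there exists a term $v$ with $u_1\to_{\lambda j}^* v$ and $u_2\to_{\lambda j}^* v$.
   Context: Terms of $\lambda j$ are generated by $t,u ::= x \mid \lambda x.t \mid t\,u \mid t[x/u]$; $[x/u]$ is a jump, and $\lambda x.t$ and $t[x/u]$ bind $x$ in $t$ (not in $u$). Terms are taken modulo $\alpha$-conversion. $\mathrm{fv}(t)$ is the set of free variables, $|t|_x$ the number of free occurrences of $x$ in $t$, $t\{x/u\}$ capture-avoiding meta-level substitution. When $|t|_x\ge2$, $t_{[y]_x}$ denotes any term obtained from $t$ by renaming $i$ free occurrences of $x$ into a fresh variable $y$, $1\le i\le|t|_x-1$. The rules of $\lambda j$ are: (dB) $(\lambda x.t)L\,u\mapsto t[x/u]L$ with $L=[x_1/u_1]\dots[x_k/u_k]$ a possibly empty list of jumps such that $\{x_1,\dots,x_k\}\cap\mathrm{fv}(u)=\emptyset$; (w) $t[x/u]\mapsto t$ if $|t|_x=0$; (d) $t[x/u]\mapsto t\{x/u\}$ if $|t|_x=1$; (c) $t[x/u]\mapsto t_{[y]_x}[x/u][y/u]$ if $|t|_x>1$, $y$ fresh. $\to_{\lambda j}$ is the contextual closure of these rules and $\to^*_{\lambda j}$ its reflexive-transitive closure. -}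

module Defs where

open import Data.Nat using (ℕ; zero; suc; _+_; _>_; _≥_)
open import Data.Fin using (Fin; zero; suc)
open import Data.Product using (∃; _×_)
open import Relation.Binary.PropositionalEquality using (_≡_)
open import Relation.Binary.Construct.Closure.ReflexiveTransitive using (Star)
open import Data.Fin using (_≟_)
import Relation.Nullary

-- Terms of λj, well-scoped de Bruijn representation (terms modulo α).
-- Tm n : terms whose free variables are among n variables (Fin n).
data Tm (n : ℕ) : Set where
  var : Fin n → Tm n
  lam : Tm (suc n) → Tm n
  app : Tm n → Tm n → Tm n
  jmp : Tm (suc n) → Tm n → Tm n          -- t[x/u], x bound (index 0) in t, not in u

Ren : ℕ → ℕ → Set
Ren n m = Fin n → Fin m

extR : ∀ {n m} → Ren n m → Ren (suc n) (suc m)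
extR ρ zero    = zero
extR ρ (suc i) = suc (ρ i)

rename : ∀ {n m} → Ren n m → Tm n → Tm m
rename ρ (var i)   = var (ρ i)
rename ρ (lam t)   = lam (rename (extR ρ) t)
rename ρ (app t u) = app (rename ρ t) (rename ρ u)
rename ρ (jmp t u) = jmp (rename (extR ρ) t) (rename ρ u)

Sub : ℕ → ℕ → Set
Sub n m = Fin n → Tm m

extS : ∀ {n m} → Sub n m → Sub (suc n) (suc m)
extS σ zero    = var zero
extS σ (suc i) = rename suc (σ i)

subst : ∀ {n m} → Sub n m → Tm n → Tm m
subst σ (var i)   = σ i
subst σ (lam t)   = lam (subst (extS σ) t)
subst σ (app t u) = app (subst σ t) (subst σ u)
subst σ (jmp t u) = jmp (subst (extS σ) t) (subst σ u)

single : ∀ {n} → Tm n → Sub (suc n) n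
single u zero    = u
single u (suc i) = var i

_[_]₀ : ∀ {n} → Tm (suc n) → Tm n → Tm n
t [ u ]₀ = subst (single u) t

occ : ∀ {n} → Fin n → Tm n → ℕ
occ i (var j) with i ≟ j
... | Relation.Nullary.yes _ = 1
... | Relation.Nullary.no  _ = 0
occ i (lam t)   = occ (suc i) t
occ i (app t u) = occ i t + occ i u
occ i (jmp t u) = occ (suc i) t + occ i u

-- Lists of jumps L = [x1/u1]...[xk/uk]; Jumps n m takes a term in scope m
-- (m = n + k, x1..xk bound) to a term in scope n.  Innermost jump first.
data Jumps (n : ℕ) : ℕ → Set where
  []  : Jumps n n
  _∷_ : ∀ {p} → Tm p → Jumps n p → Jumps n (suc p)

wrap : ∀ {n m} → Jumps n m → Tm m → Tm n
wrap []      t = t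
wrap (u ∷ L) t = wrap L (jmp t u)

-- weakening of a term in scope n past the variables bound by L
-- (this realises the side condition {x1..xk} ∩ fv(u) = ∅)
wkJ : ∀ {n m} → Jumps n m → Tm n → Tm m
wkJ []      t = t
wkJ (u ∷ L) t = rename suc (wkJ L t)

-- merge y (index 1) into x (index 0): inverse of t ↦ t_{[y]_x}
merge : ∀ {n} → Ren (suc (suc n)) (suc n)
merge zero          = zero
merge (suc zero)    = zero
merge (suc (suc i)) = suc i

infix 4 _↦_ _⟶_ _⟶*_

data _↦_ {n : ℕ} : Tm n → Tm n → Set where
  dB : ∀ {m} (L : Jumps n m) (t : Tm (suc m)) (u : Tm n) →
       app (wrap L (lam t)) u ↦ wrap L (jmp t (wkJ L u))
  -- |t|_x = 0 : t is (the weakening of) a term t' not mentioning x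
  w  : (t : Tm n) (u : Tm n) → jmp (rename suc t) u ↦ t
  d  : (t : Tm (suc n)) (u : Tm n) → occ zero t ≡ 1 → jmp t u ↦ t [ u ]₀
  -- t' = t_{[y]_x}: y is index 1 (outer jump), x index 0 (inner jump);
  -- renaming y back to x gives t; at least one occurrence renamed,
  -- at least one kept.
  c  : (t : Tm (suc n)) (t' : Tm (suc (suc n))) (u : Tm n) →
       occ zero t > 1 →
       rename merge t' ≡ t → occ zero t' ≥ 1 → occ (suc zero) t' ≥ 1 →
       jmp t u ↦ jmp (jmp t' (rename suc u)) u

data _⟶_ : {n : ℕ} → Tm n → Tm n → Set where
  root  : ∀ {n} {t t' : Tm n} → t ↦ t' → t ⟶ t'
  lamC  : ∀ {n} {t t' : Tm (suc n)} → t ⟶ t' → lam t ⟶ lam t'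
  appL  : ∀ {n} {t t' u : Tm n} → t ⟶ t' → app t u ⟶ app t' u
  appR  : ∀ {n} {t u u' : Tm n} → u ⟶ u' → app t u ⟶ app t u'
  jmpL  : ∀ {n} {t t' : Tm (suc n)} {u : Tm n} → t ⟶ t' → jmp t u ⟶ jmp t' u
  jmpR  : ∀ {n} {t : Tm (suc n)} {u u' : Tm n} → u ⟶ u' → jmp t u ⟶ jmp t u'

_⟶*_ : ∀ {n} → Tm n → Tm n → Set
_⟶*_ = Star _⟶_

-- Unfolding every jump t[x/u] into the meta-level substitution t{x/u} maps λj
-- onto the λ-calculus: a λj step becomes a parallel β-step (dB is a β-redex,
-- while w, d and c do not change the unfolding at all).  Conversely every
-- parallel β-step, and the unfolding itself, is a λj reduction: a β-redex is
-- fired by dB, and a jump is eliminated by repeatedly splitting off one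
-- occurrence with c until d or w applies.  Confluence of parallel β-reduction
-- (Takahashi's triangle property) therefore transfers to λj.
module Submission where

open import Defs
open import Data.Nat using (ℕ; zero; suc; _+_; _>_; _≥_; z≤n; s≤s)
open import Data.Nat.Properties as ℕ using (m+n≡0⇒m≡0; m+n≡0⇒n≡0; +-suc)
open import Data.Fin using (Fin; zero; suc; _≟_; punchIn; punchOut)
open import Data.Fin.Properties using (punchIn-punchOut; suc-injective)
open import Data.Product using (∃; _×_; _,_; -,_)
open import Data.Empty using (⊥-elim)
open import Function using (_∘_)
open import Function.Definitions using (Injective)
open import Relation.Nullary using (yes; no)
open import Relation.Binary.Core using (Rel; _⇒_; _=[_]⇒_)
open import Relation.Binary.PropositionalEquality
  using (_≡_; refl; sym; trans; cong; cong₂; _≢_; _≗_; module ≡-Reasoning)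
  renaming (subst to ≡-subst)
open import Relation.Binary.Construct.Closure.ReflexiveTransitive
  using (Star; ε; _◅_; _◅◅_; gmap; kleisliStar; _⋆; return)
open import Relation.Binary.Rewriting using (Confluent)

-- Abstract rewriting

module _ {a ℓ} {A : Set a} {R : Rel A ℓ} where

  triangle⇒confluent : (ρ : A → A) → (∀ {a b} → R a b → R b (ρ a)) → Confluent R
  triangle⇒confluent ρ triangle = confluent
    where
    strip : ∀ {a b c} → R a b → Star R a c → ∃ λ v → Star R b v × R c v
    strip a→b ε = -, ε , a→b
    strip a→b (a→x ◅ x→*c) with strip (triangle a→x) x→*c
    ... | v , ρa→*v , c→v = v , triangle a→b ◅ ρa→*v , c→v

    confluent : Confluent R
    confluent ε a→*c = -, a→*c , ε
    confluent (a→x ◅ x→*b) a→*c with strip a→x a→*c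
    ... | y , x→*y , c→y with confluent x→*b x→*y
    ... | v , b→*v , y→*v = v , b→*v , c→y ◅ y→*v

module _ {a ℓ₁ ℓ₂} {A : Set a} {R : Rel A ℓ₁} {S : Rel A ℓ₂} where

  confluent-by-projection : (f : A → A) → R =[ f ]⇒ Star S → (∀ a → Star R a (f a)) →
                            S ⇒ Star R → Confluent S → Confluent R
  confluent-by-projection f project reach lift confluent-S a→*b a→*c
    with confluent-S (kleisliStar f project a→*b) (kleisliStar f project a→*c)
  ... | v , fb→*v , fc→*v = v , reach _ ◅◅ (lift ⋆) fb→*v , reach _ ◅◅ (lift ⋆) fc→*v

-- Renaming and substitution

extR-cong : ∀ {n m} {ρ ρ' : Ren n m} → ρ ≗ ρ' → extR ρ ≗ extR ρ'
extR-cong e zero    = refl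
extR-cong e (suc i) = cong suc (e i)

rename-cong : ∀ {n m} {ρ ρ' : Ren n m} → ρ ≗ ρ' → rename ρ ≗ rename ρ'
rename-cong e (var i)   = cong var (e i)
rename-cong e (lam t)   = cong lam (rename-cong (extR-cong e) t)
rename-cong e (app t u) = cong₂ app (rename-cong e t) (rename-cong e u)
rename-cong e (jmp t u) = cong₂ jmp (rename-cong (extR-cong e) t) (rename-cong e u)

extS-cong : ∀ {n m} {σ σ' : Sub n m} → σ ≗ σ' → extS σ ≗ extS σ'
extS-cong e zero    = refl
extS-cong e (suc i) = cong (rename suc) (e i)

subst-cong : ∀ {n m} {σ σ' : Sub n m} → σ ≗ σ' → subst σ ≗ subst σ'
subst-cong e (var i)   = e i
subst-cong e (lam t)   = cong lam (subst-cong (extS-cong e) t)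
subst-cong e (app t u) = cong₂ app (subst-cong e t) (subst-cong e u)
subst-cong e (jmp t u) = cong₂ jmp (subst-cong (extS-cong e) t) (subst-cong e u)

extR-∘ : ∀ {n m k} (ρ : Ren m k) (ρ' : Ren n m) → extR ρ ∘ extR ρ' ≗ extR (ρ ∘ ρ')
extR-∘ ρ ρ' zero    = refl
extR-∘ ρ ρ' (suc i) = refl

rename-rename : ∀ {n m k} (ρ : Ren m k) (ρ' : Ren n m) t →
                rename ρ (rename ρ' t) ≡ rename (ρ ∘ ρ') t
rename-rename ρ ρ' (var i)   = refl
rename-rename ρ ρ' (lam t)   =
  cong lam (trans (rename-rename (extR ρ) (extR ρ') t) (rename-cong (extR-∘ ρ ρ') t))
rename-rename ρ ρ' (app t u) = cong₂ app (rename-rename ρ ρ' t) (rename-rename ρ ρ' u)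
rename-rename ρ ρ' (jmp t u) =
  cong₂ jmp (trans (rename-rename (extR ρ) (extR ρ') t) (rename-cong (extR-∘ ρ ρ') t))
            (rename-rename ρ ρ' u)

extS-extR : ∀ {n m k} (σ : Sub m k) (ρ : Ren n m) → extS σ ∘ extR ρ ≗ extS (σ ∘ ρ)
extS-extR σ ρ zero    = refl
extS-extR σ ρ (suc i) = refl

subst-rename : ∀ {n m k} (σ : Sub m k) (ρ : Ren n m) t →
               subst σ (rename ρ t) ≡ subst (σ ∘ ρ) t
subst-rename σ ρ (var i)   = refl
subst-rename σ ρ (lam t)   =
  cong lam (trans (subst-rename (extS σ) (extR ρ) t) (subst-cong (extS-extR σ ρ) t))
subst-rename σ ρ (app t u) = cong₂ app (subst-rename σ ρ t) (subst-rename σ ρ u)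
subst-rename σ ρ (jmp t u) =
  cong₂ jmp (trans (subst-rename (extS σ) (extR ρ) t) (subst-cong (extS-extR σ ρ) t))
            (subst-rename σ ρ u)

rename-extS : ∀ {n m k} (ρ : Ren m k) (σ : Sub n m) →
              rename (extR ρ) ∘ extS σ ≗ extS (rename ρ ∘ σ)
rename-extS ρ σ zero    = refl
rename-extS ρ σ (suc i) = trans (rename-rename (extR ρ) suc (σ i)) (sym (rename-rename suc ρ (σ i)))

rename-subst : ∀ {n m k} (ρ : Ren m k) (σ : Sub n m) t →
               rename ρ (subst σ t) ≡ subst (rename ρ ∘ σ) t
rename-subst ρ σ (var i)   = refl
rename-subst ρ σ (lam t)   =
  cong lam (trans (rename-subst (extR ρ) (extS σ) t) (subst-cong (rename-extS ρ σ) t))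
rename-subst ρ σ (app t u) = cong₂ app (rename-subst ρ σ t) (rename-subst ρ σ u)
rename-subst ρ σ (jmp t u) =
  cong₂ jmp (trans (rename-subst (extR ρ) (extS σ) t) (subst-cong (rename-extS ρ σ) t))
            (rename-subst ρ σ u)

subst-extS : ∀ {n m k} (σ : Sub m k) (σ' : Sub n m) →
             subst (extS σ) ∘ extS σ' ≗ extS (subst σ ∘ σ')
subst-extS σ σ' zero    = refl
subst-extS σ σ' (suc i) = trans (subst-rename (extS σ) suc (σ' i)) (sym (rename-subst suc σ (σ' i)))

subst-subst : ∀ {n m k} (σ : Sub m k) (σ' : Sub n m) t →
              subst σ (subst σ' t) ≡ subst (subst σ ∘ σ') t
subst-subst σ σ' (var i)   = refl
subst-subst σ σ' (lam t)   =
  cong lam (trans (subst-subst (extS σ) (extS σ') t) (subst-cong (subst-extS σ σ') t))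
subst-subst σ σ' (app t u) = cong₂ app (subst-subst σ σ' t) (subst-subst σ σ' u)
subst-subst σ σ' (jmp t u) =
  cong₂ jmp (trans (subst-subst (extS σ) (extS σ') t) (subst-cong (subst-extS σ σ') t))
            (subst-subst σ σ' u)

extS-var : ∀ {n} → extS {n} var ≗ var
extS-var zero    = refl
extS-var (suc i) = refl

subst-var : ∀ {n} (t : Tm n) → subst var t ≡ t
subst-var (var i)   = refl
subst-var (lam t)   = cong lam (trans (subst-cong extS-var t) (subst-var t))
subst-var (app t u) = cong₂ app (subst-var t) (subst-var u)
subst-var (jmp t u) = cong₂ jmp (trans (subst-cong extS-var t) (subst-var t)) (subst-var u)

extR-id : ∀ {n} → extR {n} (λ i → i) ≗ (λ i → i)
extR-id zero    = refl
extR-id (suc i) = refl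

rename-id : ∀ {n} (t : Tm n) → rename (λ i → i) t ≡ t
rename-id (var i)   = refl
rename-id (lam t)   = cong lam (trans (rename-cong extR-id t) (rename-id t))
rename-id (app t u) = cong₂ app (rename-id t) (rename-id u)
rename-id (jmp t u) = cong₂ jmp (trans (rename-cong extR-id t) (rename-id t)) (rename-id u)

weaken-[]₀ : ∀ {n} (t u : Tm n) → rename suc t [ u ]₀ ≡ t
weaken-[]₀ t u = trans (subst-rename (single u) suc t) (subst-var t)

rename-[]₀ : ∀ {n m} (ρ : Ren n m) t u → rename ρ (t [ u ]₀) ≡ rename (extR ρ) t [ rename ρ u ]₀
rename-[]₀ ρ t u = trans (rename-subst ρ (single u) t)
  (trans (subst-cong commute t) (sym (subst-rename (single (rename ρ u)) (extR ρ) t)))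
  where
  commute : rename ρ ∘ single u ≗ single (rename ρ u) ∘ extR ρ
  commute zero    = refl
  commute (suc i) = refl

subst-[]₀ : ∀ {n m} (σ : Sub n m) t u → subst σ (t [ u ]₀) ≡ subst (extS σ) t [ subst σ u ]₀
subst-[]₀ σ t u = trans (subst-subst σ (single u) t)
  (trans (subst-cong commute t) (sym (subst-subst (single (subst σ u)) (extS σ) t)))
  where
  commute : subst σ ∘ single u ≗ subst (single (subst σ u)) ∘ extS σ
  commute zero    = refl
  commute (suc i) = sym (weaken-[]₀ (σ i) (subst σ u))

merge-[]₀ : ∀ {n} (t : Tm (suc (suc n))) (u : Tm n) →
            t [ rename suc u ]₀ [ u ]₀ ≡ rename merge t [ u ]₀
merge-[]₀ t u = trans (subst-subst (single u) (single (rename suc u)) t)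
  (trans (subst-cong agree t) (sym (subst-rename (single u) merge t)))
  where
  agree : subst (single u) ∘ single (rename suc u) ≗ single u ∘ merge
  agree zero          = weaken-[]₀ u u
  agree (suc zero)    = refl
  agree (suc (suc i)) = refl

-- Parallel β-reduction and its confluence

infix 4 _⇛_

data _⇛_ {n : ℕ} : Tm n → Tm n → Set where
  var : ∀ {i} → var i ⇛ var i
  lam : ∀ {t t'} → t ⇛ t' → lam t ⇛ lam t'
  app : ∀ {t t' u u'} → t ⇛ t' → u ⇛ u' → app t u ⇛ app t' u'
  jmp : ∀ {t t' u u'} → t ⇛ t' → u ⇛ u' → jmp t u ⇛ jmp t' u'
  β   : ∀ {t t' u u'} → t ⇛ t' → u ⇛ u' → app (lam t) u ⇛ t' [ u' ]₀

⇛-refl : ∀ {n} (t : Tm n) → t ⇛ t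
⇛-refl (var i)   = var
⇛-refl (lam t)   = lam (⇛-refl t)
⇛-refl (app t u) = app (⇛-refl t) (⇛-refl u)
⇛-refl (jmp t u) = jmp (⇛-refl t) (⇛-refl u)

⇛-reflexive : ∀ {n} {t t' : Tm n} → t ≡ t' → t ⇛ t'
⇛-reflexive refl = ⇛-refl _

⇛-≡ : ∀ {n} {t s s' : Tm n} → t ⇛ s → s ≡ s' → t ⇛ s'
⇛-≡ t⇛s refl = t⇛s

⇛-rename : ∀ {n m} (ρ : Ren n m) {t t'} → t ⇛ t' → rename ρ t ⇛ rename ρ t'
⇛-rename ρ var         = var
⇛-rename ρ (lam p)     = lam (⇛-rename (extR ρ) p)
⇛-rename ρ (app p q)   = app (⇛-rename ρ p) (⇛-rename ρ q)
⇛-rename ρ (jmp p q)   = jmp (⇛-rename (extR ρ) p) (⇛-rename ρ q)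
⇛-rename ρ (β {t' = t'} {u' = u'} p q) =
  ⇛-≡ (β (⇛-rename (extR ρ) p) (⇛-rename ρ q)) (sym (rename-[]₀ ρ t' u'))

⇛-extS : ∀ {n m} {σ σ' : Sub n m} → (∀ i → σ i ⇛ σ' i) → ∀ i → extS σ i ⇛ extS σ' i
⇛-extS σ⇛σ' zero    = var
⇛-extS σ⇛σ' (suc i) = ⇛-rename suc (σ⇛σ' i)

⇛-subst : ∀ {n m} {σ σ' : Sub n m} → (∀ i → σ i ⇛ σ' i) →
          ∀ {t t'} → t ⇛ t' → subst σ t ⇛ subst σ' t'
⇛-subst σ⇛σ' var       = σ⇛σ' _
⇛-subst σ⇛σ' (lam p)   = lam (⇛-subst (⇛-extS σ⇛σ') p)
⇛-subst σ⇛σ' (app p q) = app (⇛-subst σ⇛σ' p) (⇛-subst σ⇛σ' q)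
⇛-subst σ⇛σ' (jmp p q) = jmp (⇛-subst (⇛-extS σ⇛σ') p) (⇛-subst σ⇛σ' q)
⇛-subst {σ' = σ'} σ⇛σ' (β {t' = t'} {u' = u'} p q) =
  ⇛-≡ (β (⇛-subst (⇛-extS σ⇛σ') p) (⇛-subst σ⇛σ' q)) (sym (subst-[]₀ σ' t' u'))

⇛-[]₀ : ∀ {n} {t t' : Tm (suc n)} {u u'} → t ⇛ t' → u ⇛ u' → t [ u ]₀ ⇛ t' [ u' ]₀
⇛-[]₀ t⇛t' u⇛u' = ⇛-subst single⇛ t⇛t'
  where
  single⇛ : ∀ i → single _ i ⇛ single _ i
  single⇛ zero    = u⇛u'
  single⇛ (suc i) = var

develop : ∀ {n} → Tm n → Tm n
develop (var i)         = var i
develop (lam t)         = lam (develop t)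
develop (app (lam t) u) = develop t [ develop u ]₀
develop (app t u)       = app (develop t) (develop u)
develop (jmp t u)       = jmp (develop t) (develop u)

⇛-develop : ∀ {n} {t s : Tm n} → t ⇛ s → s ⇛ develop t
⇛-develop var                   = var
⇛-develop (lam p)               = lam (⇛-develop p)
⇛-develop (app (lam p) q)       = β (⇛-develop p) (⇛-develop q)
⇛-develop (app p@var q)         = app (⇛-develop p) (⇛-develop q)
⇛-develop (app p@(app _ _) q)   = app (⇛-develop p) (⇛-develop q)
⇛-develop (app p@(jmp _ _) q)   = app (⇛-develop p) (⇛-develop q)
⇛-develop (app p@(β _ _) q)     = app (⇛-develop p) (⇛-develop q)
⇛-develop (jmp p q)             = jmp (⇛-develop p) (⇛-develop q)
⇛-develop (β p q)               = ⇛-[]₀ (⇛-develop p) (⇛-develop q)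

⇛-confluent : ∀ {n} → Confluent (_⇛_ {n})
⇛-confluent = triangle⇒confluent develop ⇛-develop

-- Unfolding jumps into meta-level substitutions

unfold : ∀ {n} → Tm n → Tm n
unfold (var i)   = var i
unfold (lam t)   = lam (unfold t)
unfold (app t u) = app (unfold t) (unfold u)
unfold (jmp t u) = unfold t [ unfold u ]₀

unfold-rename : ∀ {n m} (ρ : Ren n m) t → unfold (rename ρ t) ≡ rename ρ (unfold t)
unfold-rename ρ (var i)   = refl
unfold-rename ρ (lam t)   = cong lam (unfold-rename (extR ρ) t)
unfold-rename ρ (app t u) = cong₂ app (unfold-rename ρ t) (unfold-rename ρ u)
unfold-rename ρ (jmp t u) = trans (cong₂ _[_]₀ (unfold-rename (extR ρ) t) (unfold-rename ρ u))
                                  (sym (rename-[]₀ ρ (unfold t) (unfold u)))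

unfold-extS : ∀ {n m} (σ : Sub n m) → unfold ∘ extS σ ≗ extS (unfold ∘ σ)
unfold-extS σ zero    = refl
unfold-extS σ (suc i) = unfold-rename suc (σ i)

unfold-subst : ∀ {n m} (σ : Sub n m) t → unfold (subst σ t) ≡ subst (unfold ∘ σ) (unfold t)
unfold-subst σ (var i)   = refl
unfold-subst σ (lam t)   =
  cong lam (trans (unfold-subst (extS σ) t) (subst-cong (unfold-extS σ) (unfold t)))
unfold-subst σ (app t u) = cong₂ app (unfold-subst σ t) (unfold-subst σ u)
unfold-subst σ (jmp t u) =
  trans (cong₂ _[_]₀ (trans (unfold-subst (extS σ) t) (subst-cong (unfold-extS σ) (unfold t)))
                     (unfold-subst σ u))
        (sym (subst-[]₀ (unfold ∘ σ) (unfold t) (unfold u)))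

unfold-[]₀ : ∀ {n} (t : Tm (suc n)) u → unfold (t [ u ]₀) ≡ unfold t [ unfold u ]₀
unfold-[]₀ t u = trans (unfold-subst (single u) t) (subst-cong unfold-single (unfold t))
  where
  unfold-single : unfold ∘ single u ≗ single (unfold u)
  unfold-single zero    = refl
  unfold-single (suc i) = refl

unfoldJumps : ∀ {n m} → Jumps n m → Sub m n
unfoldJumps []      = var
unfoldJumps (u ∷ L) = subst (unfoldJumps L) ∘ single (unfold u)

unfold-wrap : ∀ {n m} (L : Jumps n m) t → unfold (wrap L t) ≡ subst (unfoldJumps L) (unfold t)
unfold-wrap []      t = sym (subst-var (unfold t))
unfold-wrap (u ∷ L) t =
  trans (unfold-wrap L (jmp t u)) (subst-subst (unfoldJumps L) (single (unfold u)) (unfold t))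

unfold-wkJ : ∀ {n m} (L : Jumps n m) u → subst (unfoldJumps L) (unfold (wkJ L u)) ≡ unfold u
unfold-wkJ []      u = subst-var (unfold u)
unfold-wkJ (v ∷ L) u = begin
  subst (unfoldJumps (v ∷ L)) (unfold (rename suc (wkJ L u)))
    ≡⟨ cong (subst (unfoldJumps (v ∷ L))) (unfold-rename suc (wkJ L u)) ⟩
  subst (unfoldJumps (v ∷ L)) (rename suc (unfold (wkJ L u)))
    ≡⟨ subst-rename (unfoldJumps (v ∷ L)) suc (unfold (wkJ L u)) ⟩
  subst (unfoldJumps L) (unfold (wkJ L u))
    ≡⟨ unfold-wkJ L u ⟩
  unfold u ∎
  where open ≡-Reasoning

unfold-↦ : ∀ {n} {t t' : Tm n} → t ↦ t' → unfold t ⇛ unfold t'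
unfold-↦ (dB L t u) rewrite unfold-wrap L (lam t) =
  ⇛-≡ (β (⇛-refl _) (⇛-refl _)) (sym contractum)
  where
  open ≡-Reasoning
  E = unfoldJumps L
  contractum : unfold (wrap L (jmp t (wkJ L u))) ≡ subst (extS E) (unfold t) [ unfold u ]₀
  contractum = begin
    unfold (wrap L (jmp t (wkJ L u)))
      ≡⟨ unfold-wrap L (jmp t (wkJ L u)) ⟩
    subst E (unfold t [ unfold (wkJ L u) ]₀)
      ≡⟨ subst-[]₀ E (unfold t) (unfold (wkJ L u)) ⟩
    subst (extS E) (unfold t) [ subst E (unfold (wkJ L u)) ]₀
      ≡⟨ cong (subst (extS E) (unfold t) [_]₀) (unfold-wkJ L u) ⟩
    subst (extS E) (unfold t) [ unfold u ]₀ ∎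
unfold-↦ (w t u)   =
  ⇛-reflexive (trans (cong (_[ unfold u ]₀) (unfold-rename suc t)) (weaken-[]₀ (unfold t) (unfold u)))
unfold-↦ (d t u _) = ⇛-reflexive (sym (unfold-[]₀ t u))
unfold-↦ (c _ t' u _ refl _ _) = ⇛-reflexive (begin
  unfold (rename merge t') [ unfold u ]₀
    ≡⟨ cong (_[ unfold u ]₀) (unfold-rename merge t') ⟩
  rename merge (unfold t') [ unfold u ]₀
    ≡⟨ sym (merge-[]₀ (unfold t') (unfold u)) ⟩
  unfold t' [ rename suc (unfold u) ]₀ [ unfold u ]₀
    ≡⟨ cong (λ v → unfold t' [ v ]₀ [ unfold u ]₀) (sym (unfold-rename suc u)) ⟩
  unfold t' [ unfold (rename suc u) ]₀ [ unfold u ]₀ ∎)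
  where open ≡-Reasoning

unfold-⟶ : ∀ {n} {t t' : Tm n} → t ⟶ t' → unfold t ⇛ unfold t'
unfold-⟶ (root r) = unfold-↦ r
unfold-⟶ (lamC s) = lam (unfold-⟶ s)
unfold-⟶ (appL s) = app (unfold-⟶ s) (⇛-refl _)
unfold-⟶ (appR s) = app (⇛-refl _) (unfold-⟶ s)
unfold-⟶ (jmpL s) = ⇛-[]₀ (unfold-⟶ s) (⇛-refl _)
unfold-⟶ (jmpR {t = t} s) = ⇛-[]₀ (⇛-refl (unfold t)) (unfold-⟶ s)

-- Occurrences

occ-var-≡ : ∀ {n} (x : Fin n) → occ x (var x) ≡ 1
occ-var-≡ x with x ≟ x
... | yes _  = refl
... | no x≢x = ⊥-elim (x≢x refl)

occ-var-≢ : ∀ {n} {x y : Fin n} → x ≢ y → occ x (var y) ≡ 0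
occ-var-≢ {x = x} {y} x≢y with x ≟ y
... | yes x≡y = ⊥-elim (x≢y x≡y)
... | no _    = refl

extR-injective : ∀ {n m} {ρ : Ren n m} → Injective _≡_ _≡_ ρ → Injective _≡_ _≡_ (extR ρ)
extR-injective inj {zero}  {zero}  _  = refl
extR-injective inj {suc i} {suc j} eq = cong suc (inj (suc-injective eq))

occ-rename-injective : ∀ {n m} (ρ : Ren n m) → Injective _≡_ _≡_ ρ →
                       ∀ x t → occ (ρ x) (rename ρ t) ≡ occ x t
occ-rename-injective ρ inj x (var y) with x ≟ y
... | yes refl = occ-var-≡ (ρ x)
... | no x≢y   = occ-var-≢ (x≢y ∘ inj)
occ-rename-injective ρ inj x (lam t)   = occ-rename-injective (extR ρ) (extR-injective inj) (suc x) t
occ-rename-injective ρ inj x (app t u) =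
  cong₂ _+_ (occ-rename-injective ρ inj x t) (occ-rename-injective ρ inj x u)
occ-rename-injective ρ inj x (jmp t u) =
  cong₂ _+_ (occ-rename-injective (extR ρ) (extR-injective inj) (suc x) t)
            (occ-rename-injective ρ inj x u)

extR-∉ : ∀ {n m} {ρ : Ren n m} {x} → (∀ i → ρ i ≢ x) → ∀ i → extR ρ i ≢ suc x
extR-∉ ∉ zero    ()
extR-∉ ∉ (suc i) eq = ∉ i (suc-injective eq)

occ-rename-∉ : ∀ {n m} (ρ : Ren n m) x → (∀ i → ρ i ≢ x) → ∀ t → occ x (rename ρ t) ≡ 0
occ-rename-∉ ρ x ∉ (var i)   = occ-var-≢ (∉ i ∘ sym)
occ-rename-∉ ρ x ∉ (lam t)   = occ-rename-∉ (extR ρ) (suc x) (extR-∉ ∉) t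
occ-rename-∉ ρ x ∉ (app t u) = cong₂ _+_ (occ-rename-∉ ρ x ∉ t) (occ-rename-∉ ρ x ∉ u)
occ-rename-∉ ρ x ∉ (jmp t u) = cong₂ _+_ (occ-rename-∉ (extR ρ) (suc x) (extR-∉ ∉) t) (occ-rename-∉ ρ x ∉ u)

occ-extS : ∀ {n m} {σ : Sub n m} {x y} → (∀ j → occ y (σ j) ≡ occ x (var j)) →
           ∀ j → occ (suc y) (extS σ j) ≡ occ (suc x) (var j)
occ-extS {σ = σ} {x} {y} transport zero    = refl
occ-extS {σ = σ} {x} {y} transport (suc j) = begin
  occ (suc y) (rename suc (σ j)) ≡⟨ occ-rename-injective suc suc-injective y (σ j) ⟩
  occ y (σ j)                    ≡⟨ transport j ⟩
  occ x (var j)                  ≡⟨ sym (occ-rename-injective suc suc-injective x (var j)) ⟩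
  occ (suc x) (var (suc j))      ∎
  where open ≡-Reasoning

occ-subst : ∀ {n m} (σ : Sub n m) {x y} → (∀ j → occ y (σ j) ≡ occ x (var j)) →
            ∀ t → occ y (subst σ t) ≡ occ x t
occ-subst σ transport (var j)   = transport j
occ-subst σ transport (lam t)   = occ-subst (extS σ) (occ-extS transport) t
occ-subst σ transport (app t u) = cong₂ _+_ (occ-subst σ transport t) (occ-subst σ transport u)
occ-subst σ transport (jmp t u) =
  cong₂ _+_ (occ-subst (extS σ) (occ-extS transport) t) (occ-subst σ transport u)

extR-punchIn : ∀ {n} (x : Fin (suc n)) → extR (punchIn x) ≗ punchIn (suc x)
extR-punchIn x zero    = refl
extR-punchIn x (suc i) = refl

strengthen : ∀ {n} (x : Fin (suc n)) t → occ x t ≡ 0 → ∃ λ t₀ → rename (punchIn x) t₀ ≡ t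
strengthen x (var y) x∉t with x ≟ y
... | no x≢y = var (punchOut x≢y) , cong var (punchIn-punchOut x≢y)
strengthen x (lam t) x∉t with strengthen (suc x) t x∉t
... | t₀ , refl = lam t₀ , cong lam (rename-cong (extR-punchIn x) t₀)
strengthen x (app t u) x∉tu
  with strengthen x t (m+n≡0⇒m≡0 _ x∉tu) | strengthen x u (m+n≡0⇒n≡0 (occ x t) x∉tu)
... | t₀ , refl | u₀ , refl = app t₀ u₀ , refl
strengthen x (jmp t u) x∉tu
  with strengthen (suc x) t (m+n≡0⇒m≡0 _ x∉tu) | strengthen x u (m+n≡0⇒n≡0 (occ (suc x) t) x∉tu)
... | t₀ , refl | u₀ , refl =
  jmp t₀ u₀ , cong (λ s → jmp s (rename (punchIn x) u₀)) (rename-cong (extR-punchIn x) t₀)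

renameFirst : ∀ {n} → Fin n → Fin n → Tm n → Tm n
renameFirst x y (var z) with x ≟ z
... | yes _ = var y
... | no _  = var z
renameFirst x y (lam t) = lam (renameFirst (suc x) (suc y) t)
renameFirst x y (app t u) with occ x t
... | zero  = app t (renameFirst x y u)
... | suc _ = app (renameFirst x y t) u
renameFirst x y (jmp t u) with occ (suc x) t
... | zero  = jmp t (renameFirst x y u)
... | suc _ = jmp (renameFirst (suc x) (suc y) t) u

rename-renameFirst : ∀ {n m} (ρ : Ren n m) x y → ρ x ≡ ρ y →
                     ∀ t → rename ρ (renameFirst x y t) ≡ rename ρ t
rename-renameFirst ρ x y ρx≡ρy (var z) with x ≟ z
... | yes refl = cong var (sym ρx≡ρy)
... | no _     = refl
rename-renameFirst ρ x y ρx≡ρy (lam t) =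
  cong lam (rename-renameFirst (extR ρ) (suc x) (suc y) (cong suc ρx≡ρy) t)
rename-renameFirst ρ x y ρx≡ρy (app t u) with occ x t
... | zero  = cong (app (rename ρ t)) (rename-renameFirst ρ x y ρx≡ρy u)
... | suc _ = cong (λ s → app s (rename ρ u)) (rename-renameFirst ρ x y ρx≡ρy t)
rename-renameFirst ρ x y ρx≡ρy (jmp t u) with occ (suc x) t
... | zero  = cong (jmp (rename (extR ρ) t)) (rename-renameFirst ρ x y ρx≡ρy u)
... | suc _ = cong (λ s → jmp s (rename ρ u))
                   (rename-renameFirst (extR ρ) (suc x) (suc y) (cong suc ρx≡ρy) t)

occ-renameFirst-source : ∀ {n} (x y : Fin n) → x ≢ y → ∀ t {k} → occ x t ≡ suc k →
                         occ x (renameFirst x y t) ≡ k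
occ-renameFirst-source x y x≢y (var z) x∈t with x ≟ z
... | yes refl = trans (occ-var-≢ x≢y) (ℕ.suc-injective x∈t)
occ-renameFirst-source x y x≢y (lam t) x∈t =
  occ-renameFirst-source (suc x) (suc y) (x≢y ∘ suc-injective) t x∈t
occ-renameFirst-source x y x≢y (app t u) x∈tu with occ x t in x∈t
... | zero  = trans (cong (_+ _) x∈t) (occ-renameFirst-source x y x≢y u x∈tu)
... | suc j = trans (cong (_+ occ x u) (occ-renameFirst-source x y x≢y t x∈t)) (ℕ.suc-injective x∈tu)
occ-renameFirst-source x y x≢y (jmp t u) x∈tu with occ (suc x) t in x∈t
... | zero  = trans (cong (_+ _) x∈t) (occ-renameFirst-source x y x≢y u x∈tu)
... | suc j = trans (cong (_+ occ x u) (occ-renameFirst-source (suc x) (suc y) (x≢y ∘ suc-injective) t x∈t))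
                    (ℕ.suc-injective x∈tu)

occ-renameFirst-target : ∀ {n} (x y : Fin n) → x ≢ y → ∀ t {k} → occ x t ≡ suc k →
                         occ y (renameFirst x y t) ≡ suc (occ y t)
occ-renameFirst-target x y x≢y (var z) x∈t with x ≟ z
... | yes refl = trans (occ-var-≡ y) (cong suc (sym (occ-var-≢ (x≢y ∘ sym))))
occ-renameFirst-target x y x≢y (lam t) x∈t =
  occ-renameFirst-target (suc x) (suc y) (x≢y ∘ suc-injective) t x∈t
occ-renameFirst-target x y x≢y (app t u) x∈tu with occ x t in x∈t
... | zero  = trans (cong (occ y t +_) (occ-renameFirst-target x y x≢y u x∈tu)) (+-suc (occ y t) (occ y u))
... | suc j = cong (_+ occ y u) (occ-renameFirst-target x y x≢y t x∈t)
occ-renameFirst-target x y x≢y (jmp t u) x∈tu with occ (suc x) t in x∈t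
... | zero  = trans (cong (occ (suc y) t +_) (occ-renameFirst-target x y x≢y u x∈tu))
                    (+-suc (occ (suc y) t) (occ y u))
... | suc j = cong (_+ occ y u) (occ-renameFirst-target (suc x) (suc y) (x≢y ∘ suc-injective) t x∈t)

split-occurrence : ∀ {n} (t : Tm (suc n)) {k} → occ zero t ≡ suc (suc k) →
                   ∃ λ t' → rename merge t' ≡ t × occ zero t' ≡ suc k × occ (suc zero) t' ≡ 1
split-occurrence {n} t {k} x∈t = t' , merge-t' , x∈t' , y∈t'
  where
  t₀ = rename (extR suc) t
  t' = renameFirst zero (suc zero) t₀

  x≢y : _≢_ {A = Fin (suc (suc n))} zero (suc zero)
  x≢y ()

  x∈t₀ : occ zero t₀ ≡ suc (suc k)
  x∈t₀ = trans (occ-rename-injective (extR suc) (extR-injective suc-injective) zero t) x∈t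

  y∉t₀ : occ (suc zero) t₀ ≡ 0
  y∉t₀ = occ-rename-∉ (extR suc) (suc zero) (extR-∉ (λ _ ())) t

  merge-extR : merge ∘ extR suc ≗ λ i → i
  merge-extR zero    = refl
  merge-extR (suc i) = refl

  merge-t' : rename merge t' ≡ t
  merge-t' = begin
    rename merge t'                ≡⟨ rename-renameFirst merge zero (suc zero) refl t₀ ⟩
    rename merge t₀                ≡⟨ rename-rename merge (extR suc) t ⟩
    rename (merge ∘ extR suc) t    ≡⟨ rename-cong merge-extR t ⟩
    rename (λ i → i) t             ≡⟨ rename-id t ⟩
    t                              ∎
    where open ≡-Reasoning

  x∈t' : occ zero t' ≡ suc k
  x∈t' = occ-renameFirst-source zero (suc zero) x≢y t₀ x∈t₀

  y∈t' : occ (suc zero) t' ≡ 1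
  y∈t' = trans (occ-renameFirst-target zero (suc zero) x≢y t₀ x∈t₀) (cong suc y∉t₀)

occ-[weaken]₀ : ∀ {n} (t : Tm (suc (suc n))) (u : Tm n) →
                occ zero (t [ rename suc u ]₀) ≡ occ (suc zero) t
occ-[weaken]₀ t u = occ-subst (single (rename suc u)) transport t
  where
  transport : ∀ j → occ zero (single (rename suc u) j) ≡ occ (suc zero) (var j)
  transport zero          = occ-rename-∉ suc zero (λ _ ()) u
  transport (suc zero)    = refl
  transport (suc (suc j)) = refl

-- λj implements meta-level substitution and parallel β-reduction

⟶*-reflexive : ∀ {n} {t t' : Tm n} → t ≡ t' → t ⟶* t'
⟶*-reflexive refl = ε

-- After c has split y off and the remaining k + 1 occurrences of x are eliminated,
-- y is the only occurrence of the outer jump variable, so d applies.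
jmp-⟶*-[]₀-contract : ∀ {k} →
  (∀ {n} (t : Tm (suc n)) (u : Tm n) → occ zero t ≡ suc k → jmp t u ⟶* t [ u ]₀) →
  ∀ {n} (t : Tm (suc n)) (u : Tm n) → occ zero t ≡ suc (suc k) → jmp t u ⟶* t [ u ]₀
jmp-⟶*-[]₀-contract eliminate t u x∈t with split-occurrence t x∈t
... | t' , merge-t' , x∈t' , y∈t' =
  root (c t t' u (≡-subst (_> 1) (sym x∈t) (s≤s (s≤s z≤n))) merge-t'
          (≡-subst (_≥ 1) (sym x∈t') (s≤s z≤n)) (≡-subst (_≥ 1) (sym y∈t') (s≤s z≤n)))
  ◅ gmap (λ s → jmp s u) jmpL (eliminate t' (rename suc u) x∈t')
  ◅◅ root (d _ u (trans (occ-[weaken]₀ t' u) y∈t'))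
  ◅ ⟶*-reflexive (trans (merge-[]₀ t' u) (cong (_[ u ]₀) merge-t'))

jmp-⟶*-[]₀-by-occ : ∀ k {n} (t : Tm (suc n)) (u : Tm n) → occ zero t ≡ k → jmp t u ⟶* t [ u ]₀
jmp-⟶*-[]₀-by-occ zero t u x∉t with strengthen zero t x∉t
... | t₀ , refl = root (w t₀ u) ◅ ⟶*-reflexive (sym (weaken-[]₀ t₀ u))
jmp-⟶*-[]₀-by-occ (suc zero)    t u x∈t = root (d t u x∈t) ◅ ε
jmp-⟶*-[]₀-by-occ (suc (suc k)) t u x∈t = jmp-⟶*-[]₀-contract (jmp-⟶*-[]₀-by-occ (suc k)) t u x∈t

jmp-⟶*-[]₀ : ∀ {n} (t : Tm (suc n)) (u : Tm n) → jmp t u ⟶* t [ u ]₀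
jmp-⟶*-[]₀ t u = jmp-⟶*-[]₀-by-occ (occ zero t) t u refl

⇛⇒⟶* : ∀ {n} {t t' : Tm n} → t ⇛ t' → t ⟶* t'
⇛⇒⟶* var = ε
⇛⇒⟶* (lam p) = gmap lam lamC (⇛⇒⟶* p)
⇛⇒⟶* (app {t' = t'} {u = u} p q) =
  gmap (λ s → app s u) appL (⇛⇒⟶* p) ◅◅ gmap (app t') appR (⇛⇒⟶* q)
⇛⇒⟶* (jmp {t' = t'} {u = u} p q) =
  gmap (λ s → jmp s u) jmpL (⇛⇒⟶* p) ◅◅ gmap (jmp t') jmpR (⇛⇒⟶* q)
⇛⇒⟶* (β {t' = t'} {u = u} p q) =
  gmap (λ s → app (lam s) u) (appL ∘ lamC) (⇛⇒⟶* p) ◅◅ gmap (app (lam t')) appR (⇛⇒⟶* q)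
  ◅◅ root (dB [] t' _) ◅ jmp-⟶*-[]₀ t' _

⟶*-unfold : ∀ {n} (t : Tm n) → t ⟶* unfold t
⟶*-unfold (var i)   = ε
⟶*-unfold (lam t)   = gmap lam lamC (⟶*-unfold t)
⟶*-unfold (app t u) =
  gmap (λ s → app s u) appL (⟶*-unfold t) ◅◅ gmap (app (unfold t)) appR (⟶*-unfold u)
⟶*-unfold (jmp t u) =
  gmap (λ s → jmp s u) jmpL (⟶*-unfold t) ◅◅ gmap (jmp (unfold t)) jmpR (⟶*-unfold u)
  ◅◅ jmp-⟶*-[]₀ (unfold t) (unfold u)

theorem2p16 : ∀ {n : ℕ} {t u₁ u₂ : Tm n} → t ⟶* u₁ → t ⟶* u₂ →
                ∃ λ (v : Tm n) → (u₁ ⟶* v) × (u₂ ⟶* v)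
theorem2p16 = confluent-by-projection unfold (return ∘ unfold-⟶) ⟶*-unfold ⇛⇒⟶* ⇛-confluent
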